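{- Let $\mathcal O$ be a finite set of objects, let $N=(P,T,F,pt,F_{var},\ell)$ be an accepting OCPN (with play places $P_{\mathrm{play}}$ and stop places $P_{\mathrm{stop}}$ as described in the context), let $N'=\mathbb T_1(N)$, and let $M_\emptyset$ denote the empty marking of $N'$. Then there exists a run of $N$ $$M_0 \xrightarrow{(t_1,b_1)} M_1 \xrightarrow{(t_2,b_2)} \cdots \xrightarrow{(t_n,b_n)} M_n$$ with $M_0=M_{\mathit{init}}^{\mathcal O}$ and $M_n=M_{\mathit{final}}^{\mathcal O}$ if and only if there is a run of $N'$ over the set of objects $\mathcal O$ $$M_\emptyset \xrightarrow{*} M_0' \xrightarrow{(t_1,\beta_1)} M_1' \xrightarrow{(t_2,\beta_2)} \cdots \xrightarrow{(t_n,\beta_n)} M_n' \xrightarrow{*} M_\emptyset$$ such that $M_i'=\mathbb T_1(M_i)$ for all $0\le i\le n$ and $\beta_i=\mathbb T_1(b_i)$ for all $1\le i\le n$, where $M_\emptyset \xrightarrow{*} M_0'$ is an emitting sequence, $M_n'\xrightarrow{*} M_\emptyset$ is a collapsing sequence, and no emitting or consuming transitions occur in between.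
   Context: Object-centric Petri nets (OCPN). Fix a set of object types $\Sigma$, a set of activities $\mathcal A$, and a set of objects, each object $o$ having a type $ot(o)\in\Sigma$. An OCPN is $N=(P,T,F,pt,F_{var},\ell)$ with finite disjoint sets of places $P$ and transitions $T$, flow relation $F\subseteq (P\times T)\cup(T\times P)$, place typing $pt:P\to\Sigma$, variable arcs $F_{var}\subseteq F$, and labelling $\ell:T\to\mathcal A\cup\{\tau\}$. Write ${}^\bullet t=\{p\mid (p,t)\in F\}$, $t^\bullet=\{p\mid (t,p)\in F\}$; $tpl(t)$ is the set of types of places in ${}^\bullet t\cup t^\bullet$, $tpl_{var}(t)$ the types of those places connected to $t$ by arcs in $F_{var}$, $tpl_{nv}(t)$ those connected by arcs in $F\setminus F_{var}$; it is assumed $tpl_{var}(t)\cap tpl_{nv}(t)=\emptyset$ for all $t$. Let $Q=\{(p,o)\mid pt(p)=ot(o)\}$; a marking is $M:Q\to\{0,1\}$. A binding execution is a pair $(t,b)$ with $b$ a function from $tpl(t)$ to sets of objects (of the respective type) such that $|b(\sigma)|=1$ for $\sigma\in tpl_{nv}(t)$. Let $cons(t,b)=\{(p,o)\mid p\in{}^\bullet t, o\in b(pt(p))\}$ and $prod(t,b)=\{(p,o)\mid p\in t^\bullet, o\in b(pt(p))\}$; $(t,b)$ is enabled in $M$ if $cons(t,b)\le M$, and firing yields $M-cons(t,b)+prod(t,b)$, written $M\xrightarrow{(t,b)}M'$. An accepting OCPN comes with sets of play places $P_{\mathrm{play}}\subseteq P$ and stop places $P_{\mathrm{stop}}\subseteq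 P$ containing, for each $\sigma\in\Sigma$, exactly one place of type $\sigma$ each. For a finite set of objects $O$, $M_{\mathit{init}}^O$ (resp. $M_{\mathit{final}}^O$) is the marking with $M(p_\sigma,o)=1$ for each $o\in O$ of type $\sigma$, where $p_\sigma$ is the play (resp. stop) place of type $\sigma$, and $0$ elsewhere. Object-centric Petri nets with identifiers (OPID). Assume a set $X$ of object variables, a set $X_{list}$ of list variables, and a set $\Upsilon$ of fresh-object variables, each typed by $\Sigma$ (list variables by list types). An inscription is a tuple $\langle x_1,\dots,x_m\rangle$ of variables with at most one list variable. An OPID is $(\Sigma,P,T,F_{in},F_{out},\mathrm{color},\ell)$ where each place has a color (a tuple of types), $F_{in}:P\times T\to$ inscriptions and $F_{out}:T\times P\to$ inscriptions are partial functions whose inscription colors match place colors, with no fresh variables on input arcs and output variables among input variables or fresh variables. A marking assigns to each place a set of object tuples of its color. A binding $\beta$ for transition $t$ in marking $M$ is a type-preserving map from the variables on $t$'s arcs to objects (list variables to lists of objects), injective on fresh variables, with fresh variables mapped to objects not occurring in $M$. For an inscription $\iota=\langle x_1,\dots,x_m\rangle$, $\vec\beta(\iota)=\{\langle\beta(x_1),\dots,\beta(x_m)\rangle\}$ if there is no list variable; if $x_i$ is a list variable with $\beta(x_i)=[u_1,\dots,u_k]$ then $\vec\beta(\iota)$ is the set of the $k$ tuples obtained by replacing position $i$ by $u_j$. $t$ is enabled with $\beta$ in $M$ if $\vec\beta(F_{in}(p,t))\subseteq M(p)$ for all input places $p$; firing yields $M'(p)=M(p)\setminus\vec\beta(F_{in}(p,t))\cup\vec\beta(F_{out}(t,p))$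 (with the removal only for input places and addition only for output places). A run is over the set of objects $\mathcal O$ if all bindings take values in $\mathcal O$ (and lists over $\mathcal O$). The mapping $\mathbb T_1$. For each $\sigma\in\Sigma$ fix variables $x_\sigma\in X$, $X_\sigma\in X_{list}$ of list type over $\sigma$, $\nu_\sigma\in\Upsilon$. $\mathbb T_1(N)$ has places $P$ with $\mathrm{color}(p)=\langle pt(p)\rangle$, transitions $T\cup T_e\cup T_c$ where $T_e=\{t_{e,\sigma}\mid\sigma\in\Sigma\}$ (emitting) and $T_c=\{t_{c,\sigma}\mid\sigma\in\Sigma\}$ (consuming) are new transitions labelled $\tau$ (other labels as in $N$); arcs: each $(t,p)$ or $(p,t)$ in $F\setminus F_{var}$ gets inscription $\langle x_{pt(p)}\rangle$, each in $F_{var}$ gets $\langle X_{pt(p)}\rangle$; $t_{e,\sigma}$ has an output arc $\langle\nu_\sigma\rangle$ to the play place of type $\sigma$; the stop place of type $\sigma$ has an input arc $\langle x_\sigma\rangle$ to $t_{c,\sigma}$. For an OCPN marking $M$, $\mathbb T_1(M)(p)=\{\langle o\rangle\mid M(p,o)>0\}$. For an OCPN binding $b$ of $t$, $\mathbb T_1(b)$ is the OPID binding $\beta$ with $\beta(x_\sigma)$ the unique element of $b(\sigma)$ when $|b(\sigma)|=1$, and otherwise $\beta(X_\sigma)$ a list containing the elements of $b(\sigma)$ in arbitrary order. An emitting sequence is a firing sequence using only transitions in $T_e$; a collapsing sequence uses only transitions in $T_c$. -}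

module Defs where

open import Data.Bool using (Bool; true; false; _∧_; _∨_; not; if_then_else_)
open import Data.Empty using (⊥)
open import Data.Unit using (⊤)
open import Data.Nat using (ℕ)
open import Data.Fin using (Fin; _≟_)
open import Data.List using (List; []; _∷_)
open import Data.List.Membership.Propositional using (_∈_)
open import Data.List.Relation.Unary.All using (All)
open import Data.List.Relation.Unary.Unique.Propositional using (Unique)
open import Data.List.Relation.Binary.Pointwise using (Pointwise)
open import Data.Maybe using (Maybe; just; nothing)
open import Data.Product using (Σ; ∃; _×_; _,_)
open import Data.Sum using (_⊎_)
open import Function.Bundles using (_⇔_)
open import Relation.Nullary using (¬_; does)
open import Relation.Binary.PropositionalEquality using (_≡_)

-- Object-centric Petri nets (OCPN)
-- Ty = object types Σ, Act = activities; labels: nothing = τ.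

record OCPN (Ty Act : Set) : Set where
  field
    np nt : ℕ
    inF   : Fin np → Fin nt → Bool
    outF  : Fin nt → Fin np → Bool
    inV   : Fin np → Fin nt → Bool          -- (p,t) ∈ F_var
    outV  : Fin nt → Fin np → Bool          -- (t,p) ∈ F_var
    inV⊆  : ∀ p t → inV p t ≡ true → inF p t ≡ true
    outV⊆ : ∀ t p → outV t p ≡ true → outF t p ≡ true
    pt    : Fin np → Ty
    ℓ     : Fin nt → Maybe Act

module _ {Ty Act : Set} (N : OCPN Ty Act) where
  open OCPN N

  Tpl : Fin nt → Ty → Set
  Tpl t σ = ∃ λ p → (inF p t ≡ true ⊎ outF t p ≡ true) × pt p ≡ σ

  TplVar : Fin nt → Ty → Set
  TplVar t σ = ∃ λ p →
    ((inF p t ≡ true × inV p t ≡ true) ⊎ (outF t p ≡ true × outV t p ≡ true))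
    × pt p ≡ σ

  TplNv : Fin nt → Ty → Set
  TplNv t σ = ∃ λ p →
    ((inF p t ≡ true × inV p t ≡ false) ⊎ (outF t p ≡ true × outV t p ≡ false))
    × pt p ≡ σ

  WellFormed : Set
  WellFormed = ∀ t σ → TplVar t σ → TplNv t σ → ⊥

  -- markings M : Q → {0,1}  (value at ill-typed pairs is never used/produced)
  MarkingN : Set → Set
  MarkingN Obj = Fin np → Obj → Bool

record Accepting {Ty Act : Set} (N : OCPN Ty Act) : Set where
  open OCPN N
  field
    play stop : Ty → Fin np
    pt-play   : ∀ σ → pt (play σ) ≡ σ
    pt-stop   : ∀ σ → pt (stop σ) ≡ σ

module _ {Ty Obj Act : Set} (ot : Obj → Ty) (N : OCPN Ty Act) where
  open OCPN N

  ValidBindingN : List Obj → Fin nt → (Ty → Obj → Bool) → Set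
  ValidBindingN 𝒪 t b =
    (∀ σ o → b σ o ≡ true → ot o ≡ σ × Tpl N t σ × o ∈ 𝒪) ×
    (∀ σ → TplNv N t σ →
       ∃ λ o → b σ o ≡ true × (∀ o' → b σ o' ≡ true → o' ≡ o))

  FireN : MarkingN N Obj → Fin nt → (Ty → Obj → Bool) → MarkingN N Obj → Set
  FireN M t b M' =
    (∀ p o → inF p t ≡ true → b (pt p) o ≡ true → M p o ≡ true) ×
    (∀ p o → M' p o ≡ ((M p o ∧ not (inF p t ∧ b (pt p) o)) ∨ (outF t p ∧ b (pt p) o)))

  module _ (A : Accepting N) where
    open Accepting A

    IsInit : List Obj → MarkingN N Obj → Set
    IsInit 𝒪 M = ∀ p o → (M p o ≡ true) ⇔ (p ≡ play (ot o) × o ∈ 𝒪)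

    IsFinal : List Obj → MarkingN N Obj → Set
    IsFinal 𝒪 M = ∀ p o → (M p o ≡ true) ⇔ (p ≡ stop (ot o) × o ∈ 𝒪)

data VKind (Ty : Set) : Set where
  obj   : Ty → VKind Ty
  list  : Ty → VKind Ty
  fresh : Ty → VKind Ty

data Val (Obj : Set) : Set where
  objV  : Obj → Val Obj
  listV : List Obj → Val Obj

record OPID (Ty Act : Set) : Set₁ where
  field
    Pl Tr Var : Set
    color  : Pl → List Ty
    kind   : Var → VKind Ty
    inArc  : Pl → Tr → Maybe (List Var)
    outArc : Tr → Pl → Maybe (List Var)
    lab    : Tr → Maybe Act

MarkingO : {Ty Act : Set} → OPID Ty Act → Set → Set
MarkingO N Obj = OPID.Pl N → List Obj → Bool

module _ {Ty Obj Act : Set} (ot : Obj → Ty) (N : OPID Ty Act) where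
  open OPID N

  Sel : (Var → Val Obj) → Var → Obj → Set
  Sel β x o = β x ≡ objV o ⊎ (∃ λ us → β x ≡ listV us × o ∈ us)

  -- tup ∈ β⃗(ι)  (inscriptions contain at most one list variable)
  Inst : (Var → Val Obj) → List Var → List Obj → Set
  Inst β ι tup = Pointwise (Sel β) ι tup

  OnArc : Tr → Var → Set
  OnArc t x = ∃ λ p → ∃ λ ι → (inArc p t ≡ just ι ⊎ outArc t p ≡ just ι) × x ∈ ι

  IsFresh : Var → Set
  IsFresh x = ∃ λ σ → kind x ≡ fresh σ

  WT : VKind Ty → Val Obj → Set
  WT (obj σ)   (objV o)   = ot o ≡ σ
  WT (fresh σ) (objV o)   = ot o ≡ σ
  WT (list σ)  (listV us) = All (λ u → ot u ≡ σ) us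
  WT _         _          = ⊥

  InO : List Obj → Val Obj → Set
  InO 𝒪 (objV o)   = o ∈ 𝒪
  InO 𝒪 (listV us) = All (_∈ 𝒪) us

  ValidBindingO : List Obj → Tr → MarkingO N Obj → (Var → Val Obj) → Set
  ValidBindingO 𝒪 t M β =
    (∀ x → OnArc t x → WT (kind x) (β x)) ×
    (∀ x y → OnArc t x → OnArc t y → IsFresh x → IsFresh y → β x ≡ β y → x ≡ y) ×
    (∀ x o → OnArc t x → IsFresh x → β x ≡ objV o →
       ∀ p tup → M p tup ≡ true → ¬ (o ∈ tup)) ×
    (∀ x → OnArc t x → InO 𝒪 (β x))

  FireO : Tr → MarkingO N Obj → (Var → Val Obj) → MarkingO N Obj → Set
  FireO t M β M' =
    (∀ p ι tup → inArc p t ≡ just ι → Inst β ι tup → M p tup ≡ true) ×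
    (∀ p tup → (M' p tup ≡ true) ⇔
       ((M p tup ≡ true × ¬ (∃ λ ι → inArc p t ≡ just ι × Inst β ι tup))
        ⊎ (∃ λ ι → outArc t p ≡ just ι × Inst β ι tup)))

  StepO : List Obj → (Tr → Set) → MarkingO N Obj → MarkingO N Obj → Set
  StepO 𝒪 allowed M M' =
    ∃ λ t → allowed t × ∃ λ β → ValidBindingO 𝒪 t M β × FireO t M β M'

data TrT1 (nt : ℕ) (Ty : Set) : Set where
  orig : Fin nt → TrT1 nt Ty
  emit : Ty → TrT1 nt Ty
  cons : Ty → TrT1 nt Ty

IsEmit : {nt : ℕ} {Ty : Set} → TrT1 nt Ty → Set
IsEmit (emit _) = ⊤
IsEmit _        = ⊥

IsCons : {nt : ℕ} {Ty : Set} → TrT1 nt Ty → Set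
IsCons (cons _) = ⊤
IsCons _        = ⊥

data VarT1 (Ty : Set) : Set where
  xv : Ty → VarT1 Ty
  Xv : Ty → VarT1 Ty
  νv : Ty → VarT1 Ty

kindT1 : {Ty : Set} → VarT1 Ty → VKind Ty
kindT1 (xv σ) = obj σ
kindT1 (Xv σ) = list σ
kindT1 (νv σ) = fresh σ

module _ {Ty Act : Set} (N : OCPN Ty Act) (A : Accepting N) where
  open OCPN N
  open Accepting A

  private
    arcVar : Bool → Fin np → VarT1 Ty
    arcVar v p = if v then Xv (pt p) else xv (pt p)

    inT1 : Fin np → TrT1 nt Ty → Maybe (List (VarT1 Ty))
    inT1 p (orig t) = if inF p t then just (arcVar (inV p t) p ∷ []) else nothing
    inT1 p (emit σ) = nothing
    inT1 p (cons σ) = if does (p ≟ stop σ) then just (xv σ ∷ []) else nothing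

    outT1 : TrT1 nt Ty → Fin np → Maybe (List (VarT1 Ty))
    outT1 (orig t) p = if outF t p then just (arcVar (outV t p) p ∷ []) else nothing
    outT1 (emit σ) p = if does (p ≟ play σ) then just (νv σ ∷ []) else nothing
    outT1 (cons σ) p = nothing

    labT1 : TrT1 nt Ty → Maybe Act
    labT1 (orig t) = ℓ t
    labT1 (emit _) = nothing
    labT1 (cons _) = nothing

  T1 : OPID Ty Act
  T1 = record
    { Pl = Fin np ; Tr = TrT1 nt Ty ; Var = VarT1 Ty
    ; color = λ p → pt p ∷ [] ; kind = kindT1
    ; inArc = inT1 ; outArc = outT1 ; lab = labT1 }

T1M : {Ty Obj Act : Set} {N : OCPN Ty Act} {A : Accepting N} →
      MarkingN N Obj → MarkingO (T1 N A) Obj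
T1M M p (o ∷ []) = M p o
T1M M p _        = false

M∅ : {Ty Obj Act : Set} (N' : OPID Ty Act) → MarkingO N' Obj
M∅ N' p tup = false

IsT1Binding : {Ty Obj Act : Set} (N : OCPN Ty Act) → Fin (OCPN.nt N) →
              (Ty → Obj → Bool) → (VarT1 Ty → Val Obj) → Set
IsT1Binding {Obj = Obj} N t b β =
  (∀ σ → TplNv N t σ → ∀ o → b σ o ≡ true → β (xv σ) ≡ objV o) ×
  (∀ σ → TplVar N t σ →
     ∃ λ (us : List Obj) → β (Xv σ) ≡ listV us × Unique us ×
        (∀ o → (o ∈ us) ⇔ (b σ o ≡ true)))

{-# OPTIONS --safe #-}
-- An OCPN marking M is represented in T₁(N) by the tuples ⟨o⟩ with M(p,o) = 1, and a binding b by
-- x_σ ↦ the single object of b(σ) and X_σ ↦ an enumeration of b(σ).  Under this representation the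
-- single-variable inscriptions of T₁(N) instantiate to exactly cons(t,b) and prod(t,b), so a firing of
-- t with b and a firing of t with T₁(b) are the same step; this gives both directions.  What remains
-- for the forward direction is to reach T₁(M_init) from the empty marking and to empty T₁(M_final):
-- the objects of 𝒪 are emitted (resp. consumed) one by one, a fresh name at each emission since 𝒪
-- has no duplicates.
module Submission where

open import Defs
open import Data.Bool using (Bool; true; false; _∧_; _∨_; not; if_then_else_)
open import Data.Bool.Properties using () renaming (_≟_ to _≟ᵇ_)
open import Data.Empty using (⊥-elim)
open import Data.Unit using (tt)
open import Data.Nat using (ℕ; suc)
open import Data.Fin using (Fin; zero; suc; fromℕ; inject₁; _≟_)
open import Data.Fin.Induction using (<-weakInduction)
open import Data.List using (List; []; _∷_; filter)
open import Data.List.Membership.Propositional using (_∈_; _∉_)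
open import Data.List.Membership.Propositional.Properties using (∈-filter⁺; ∈-filter⁻)
open import Data.List.Relation.Binary.Pointwise using ([]; _∷_)
open import Data.List.Relation.Binary.Subset.Propositional using (_⊆_)
import Data.List.Relation.Unary.All as All
open import Data.List.Relation.Unary.AllPairs using (_∷_)
open import Data.List.Relation.Unary.Any using (here; there)
open import Data.List.Relation.Unary.Any.Properties using (singleton⁻)
open import Data.List.Relation.Unary.Unique.Propositional using (Unique)
open import Data.List.Relation.Unary.Unique.Propositional.Properties using (Unique[x∷xs]⇒x∉xs; filter⁺)
open import Data.Maybe using (Maybe; just; nothing)
open import Data.Product using (Σ; ∃; ∃₂; _×_; _,_; proj₁; proj₂)
open import Data.Sum using (_⊎_; inj₁; inj₂; [_,_]; map₁)
open import Function using (_∘_; id; const)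
open import Function.Bundles using (_⇔_; mk⇔; Equivalence)
open import Function.Construct.Composition using (_⇔-∘_)
open import Function.Construct.Identity using (⇔-id)
open import Function.Construct.Symmetry using (⇔-sym)
open import Relation.Nullary using (¬_; Dec; yes; no; does)
open import Relation.Nullary.Decidable using (map′)
open import Relation.Binary.PropositionalEquality using (_≡_; refl; sym; trans; cong; subst)
open import Relation.Binary.Construct.Closure.ReflexiveTransitive using (Star; ε; _◅_; _◅◅_; return)

∧-≡true : ∀ {x y} → (x ∧ y ≡ true) ⇔ (x ≡ true × y ≡ true)
∧-≡true {true}  {true}  = mk⇔ (λ _ → refl , refl) (λ _ → refl)
∧-≡true {true}  {false} = mk⇔ (λ ()) (λ { (_ , ()) })
∧-≡true {false}         = mk⇔ (λ ()) (λ { (() , _) })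

firing-≡true : ∀ a c e → ((a ∧ not c) ∨ e ≡ true) ⇔ ((a ≡ true × ¬ c ≡ true) ⊎ e ≡ true)
firing-≡true true  false e = mk⇔ (λ _ → inj₁ (refl , λ ())) (λ _ → refl)
firing-≡true true  true  e = mk⇔ inj₂ [ (λ (_ , c≢true) → ⊥-elim (c≢true refl)) , id ]
firing-≡true false c     e = mk⇔ inj₂ [ (λ { (() , _) }) , id ]

≡⇔≡true⇔≡true : ∀ {x y} → (x ≡ y) ⇔ ((x ≡ true) ⇔ (y ≡ true))
≡⇔≡true⇔≡true = mk⇔ (λ { refl → ⇔-id _ }) from
  where
  from : ∀ {x y} → (x ≡ true) ⇔ (y ≡ true) → x ≡ y
  from {true}  {true}  _   = refl
  from {true}  {false} x⇔y = sym (Equivalence.to x⇔y refl)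
  from {false} {true}  x⇔y = Equivalence.from x⇔y refl
  from {false} {false} _   = refl

if-just⇔ : ∀ {X : Set} c {x y : X} → ((if c then just x else nothing) ≡ just y) ⇔ (c ≡ true × x ≡ y)
if-just⇔ true  = mk⇔ (λ { refl → refl , refl }) (λ { (refl , refl) → refl })
if-just⇔ false = mk⇔ (λ ()) (λ { (() , _) })

-- Uniqueness makes the proof of x ∈ y ∷ ys canonical, so it says whether x is the head.
∈-tail? : ∀ {X : Set} {y : X} {ys} → Unique (y ∷ ys) → (∀ x → Dec (x ∈ y ∷ ys)) → ∀ x → Dec (x ∈ ys)
∈-tail? u ∈? x with ∈? x
... | yes (here refl)  = no (Unique[x∷xs]⇒x∉xs u)
... | yes (there x∈ys) = yes x∈ys
... | no x∉            = no (x∉ ∘ there)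

⇔-on-singletons : ∀ {X : Set} {P Q : List X → Set} →
  (∀ {xs} → P xs → ∃ λ x → xs ≡ x ∷ []) → (∀ {xs} → Q xs → ∃ λ x → xs ≡ x ∷ []) →
  (∀ x → P (x ∷ []) ⇔ Q (x ∷ [])) → ∀ xs → P xs ⇔ Q xs
⇔-on-singletons {X} {P} {Q} P-single Q-single agree xs =
  mk⇔ (transfer {P} {Q} P-single (Equivalence.to ∘ agree))
      (transfer {Q} {P} Q-single (Equivalence.from ∘ agree))
  where
  transfer : ∀ {R S : List X → Set} → (∀ {xs} → R xs → ∃ λ x → xs ≡ x ∷ []) →
             (∀ x → R (x ∷ []) → S (x ∷ [])) → ∀ {xs} → R xs → S xs
  transfer R-single f r with R-single r
  ... | x , refl = f x r

headVal : ∀ {Obj : Set} → List Obj → Val Obj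
headVal []      = listV []
headVal (o ∷ _) = objV o

headVal-≡ : ∀ {Obj : Set} {o : Obj} {os} → o ∈ os → (∀ {o′} → o′ ∈ os → o′ ≡ o) → headVal os ≡ objV o
headVal-≡ {os = _ ∷ _} _ all≡o = cong objV (all≡o (here refl))

module Simulation {Ty Obj Act : Set} (ot : Obj → Ty) {N : OCPN Ty Act} (A : Accepting N) where
  open OCPN N
  open Accepting A

  N′ : OPID Ty Act
  N′ = T1 N A

  Represents : MarkingO N′ Obj → MarkingN N Obj → Set
  Represents M m = ∀ p tup → M p tup ≡ T1M {N = N} {A = A} m p tup

  T1M-singleton : ∀ {m : MarkingN N Obj} {p : Fin np} tup →
    T1M {N = N} {A = A} m p tup ≡ true → ∃ λ o → tup ≡ o ∷ []
  T1M-singleton (o ∷ [])    _  = o , refl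
  T1M-singleton []          ()
  T1M-singleton (_ ∷ _ ∷ _) ()

  singleArc : Bool → VarT1 Ty → Maybe (List (VarT1 Ty))
  singleArc c x = if c then just (x ∷ []) else nothing

  singleArc-var : ∀ {c x y ι} → singleArc c y ≡ just ι → x ∈ ι → x ≡ y
  singleArc-var {c} e x∈ι with Equivalence.to (if-just⇔ c) e
  ... | _ , refl = singleton⁻ x∈ι

  ArcInstance : (VarT1 Ty → Val Obj) → Maybe (List (VarT1 Ty)) → List Obj → Set
  ArcInstance β arc tup = ∃ λ ι → arc ≡ just ι × Inst ot N′ β ι tup

  singleArc-instance : ∀ {β c x tup} → ArcInstance β (singleArc c x) tup → ∃ λ o → tup ≡ o ∷ []
  singleArc-instance {c = c} (_ , e , inst) with Equivalence.to (if-just⇔ c) e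
  singleArc-instance (_ , _ , _ ∷ []) | _ , refl = _ , refl

  FiredO : TrT1 nt Ty → (VarT1 Ty → Val Obj) → MarkingO N′ Obj → Fin np → List Obj → Set
  FiredO t β M p tup =
    (M p tup ≡ true × ¬ ArcInstance β (OPID.inArc N′ p t) tup) ⊎ ArcInstance β (OPID.outArc N′ t p) tup

  -- The variable on the arcs of T₁(N) that come from N; it unfolds to the one used in the definition of T1.
  arcVar : Bool → Fin np → VarT1 Ty
  arcVar v p = if v then Xv (pt p) else xv (pt p)

  arcVar-not-fresh : ∀ v p → ¬ IsFresh ot N′ (arcVar v p)
  arcVar-not-fresh false p (_ , ())
  arcVar-not-fresh true  p (_ , ())

  ArcTyping : Fin nt → Fin np → Bool → Set
  ArcTyping t p false = TplNv N t (pt p)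
  ArcTyping t p true  = TplVar N t (pt p)

  in-arc-typing : ∀ {p t} → inF p t ≡ true → ArcTyping t p (inV p t)
  in-arc-typing {p} {t} c with inV p t in v
  ... | false = p , inj₁ (c , v) , refl
  ... | true  = p , inj₁ (c , v) , refl

  out-arc-typing : ∀ {p t} → outF t p ≡ true → ArcTyping t p (outV t p)
  out-arc-typing {p} {t} c with outV t p in v
  ... | false = p , inj₂ (c , v) , refl
  ... | true  = p , inj₂ (c , v) , refl

  orig-on-arc : ∀ {t x} → OnArc ot N′ (orig t) x → ∃₂ λ p v → ArcTyping t p v × x ≡ arcVar v p
  orig-on-arc {t} (p , _ , inj₁ e , x∈ι) =
    p , inV p t , in-arc-typing (proj₁ (Equivalence.to (if-just⇔ (inF p t)) e)) , singleArc-var e x∈ι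
  orig-on-arc {t} (p , _ , inj₂ e , x∈ι) =
    p , outV t p , out-arc-typing (proj₁ (Equivalence.to (if-just⇔ (outF t p)) e)) , singleArc-var e x∈ι

  module _ {𝒪 : List Obj} {t : Fin nt} {b : Ty → Obj → Bool} {β : VarT1 Ty → Val Obj}
           (vb : ValidBindingN ot N 𝒪 t b) (ib : IsT1Binding N t b β) where

    sel-arcVar : ∀ {p v o} → ArcTyping t p v → Sel ot N′ β (arcVar v p) o ⇔ (b (pt p) o ≡ true)
    sel-arcVar {p} {false} {o} nv with proj₂ vb (pt p) nv
    ... | o₀ , b₀ , _ = mk⇔ to (inj₁ ∘ proj₁ ib (pt p) nv o)
      where
      βx≡o₀ : β (xv (pt p)) ≡ objV o₀
      βx≡o₀ = proj₁ ib (pt p) nv o₀ b₀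
      to : Sel ot N′ β (xv (pt p)) o → b (pt p) o ≡ true
      to (inj₁ βx≡o) with trans (sym βx≡o₀) βx≡o
      ... | refl = b₀
      to (inj₂ (_ , βx≡os , _)) with trans (sym βx≡o₀) βx≡os
      ... | ()
    sel-arcVar {p} {true} {o} tv with proj₂ ib (pt p) tv
    ... | os , βX≡os , _ , ∈os⇔ = mk⇔ to (λ bo → inj₂ (os , βX≡os , Equivalence.from (∈os⇔ o) bo))
      where
      to : Sel ot N′ β (Xv (pt p)) o → b (pt p) o ≡ true
      to (inj₁ βX≡o) with trans (sym βX≡os) βX≡o
      ... | ()
      to (inj₂ (_ , βX≡os′ , o∈os′)) with trans (sym βX≡os) βX≡os′
      ... | refl = Equivalence.to (∈os⇔ o) o∈os′

    arcVar-valid : ∀ {p v} → ArcTyping t p v →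
      WT ot N′ (kindT1 (arcVar v p)) (β (arcVar v p)) × InO ot N′ 𝒪 (β (arcVar v p))
    arcVar-valid {p} {false} nv with proj₂ vb (pt p) nv
    ... | o₀ , b₀ , _ rewrite proj₁ ib (pt p) nv o₀ b₀ with proj₁ vb (pt p) o₀ b₀
    ...   | typed , _ , o₀∈𝒪 = typed , o₀∈𝒪
    arcVar-valid {p} {true} tv with proj₂ ib (pt p) tv
    ... | os , βX≡os , _ , ∈os⇔ rewrite βX≡os =
      All.tabulate (proj₁ ∘ bound) , All.tabulate (proj₂ ∘ proj₂ ∘ bound)
      where
      bound : ∀ {o} → o ∈ os → ot o ≡ pt p × Tpl N t (pt p) × o ∈ 𝒪
      bound {o} o∈os = proj₁ vb (pt p) o (Equivalence.to (∈os⇔ o) o∈os)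

    orig-valid : ∀ M → ValidBindingO ot N′ 𝒪 (orig t) M β
    orig-valid M =
      (λ _ a → proj₁ (valid-on-arc a)) ,
      (λ _ _ a _ x-fresh → ⊥-elim (not-fresh a x-fresh)) ,
      (λ _ _ a x-fresh → ⊥-elim (not-fresh a x-fresh)) ,
      (λ _ a → proj₂ (valid-on-arc a))
      where
      valid-on-arc : ∀ {x} → OnArc ot N′ (orig t) x → WT ot N′ (kindT1 x) (β x) × InO ot N′ 𝒪 (β x)
      valid-on-arc a with orig-on-arc a
      ... | _ , _ , typing , refl = arcVar-valid typing
      not-fresh : ∀ {x} → OnArc ot N′ (orig t) x → ¬ IsFresh ot N′ x
      not-fresh a with orig-on-arc a
      ... | p , v , _ , refl = arcVar-not-fresh v p

    arcVar-instance : ∀ {p c v} → (c ≡ true → ArcTyping t p v) → ∀ o →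
      ArcInstance β (singleArc c (arcVar v p)) (o ∷ []) ⇔ (c ∧ b (pt p) o ≡ true)
    arcVar-instance {p} {c} {v} typing o = mk⇔ to from
      where
      to : ArcInstance β (singleArc c (arcVar v p)) (o ∷ []) → c ∧ b (pt p) o ≡ true
      to (_ , e , s ∷ []) with Equivalence.to (if-just⇔ c) e
      ... | c≡true , refl =
        Equivalence.from ∧-≡true (c≡true , Equivalence.to (sel-arcVar (typing c≡true)) s)
      from : c ∧ b (pt p) o ≡ true → ArcInstance β (singleArc c (arcVar v p)) (o ∷ [])
      from cb with Equivalence.to ∧-≡true cb
      ... | c≡true , bo = _ , Equivalence.from (if-just⇔ c) (c≡true , refl) ,
                          Equivalence.from (sel-arcVar (typing c≡true)) bo ∷ []

    in-instance : ∀ p o → ArcInstance β (OPID.inArc N′ p (orig t)) (o ∷ []) ⇔ (inF p t ∧ b (pt p) o ≡ true)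
    in-instance p o = arcVar-instance (in-arc-typing {p}) o

    out-instance : ∀ p o → ArcInstance β (OPID.outArc N′ (orig t) p) (o ∷ []) ⇔ (outF t p ∧ b (pt p) o ≡ true)
    out-instance p o = arcVar-instance (out-arc-typing {p}) o

    module _ {m m′ : MarkingN N Obj} {M M′ : MarkingO N′ Obj}
             (hM : Represents M m) (hM′ : Represents M′ m′) where

      firedN : Fin np → Obj → Bool
      firedN p o = (m p o ∧ not (inF p t ∧ b (pt p) o)) ∨ (outF t p ∧ b (pt p) o)

      fired-singleton : ∀ {p tup} → FiredO (orig t) β M p tup → ∃ λ o → tup ≡ o ∷ []
      fired-singleton {p} {tup} =
        [ T1M-singleton tup ∘ trans (sym (hM p tup)) ∘ proj₁ , singleArc-instance {c = outF t p} ]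

      fired-at : ∀ p o → FiredO (orig t) β M p (o ∷ []) ⇔ (firedN p o ≡ true)
      fired-at p o = mk⇔ to from
        where
        rule : (firedN p o ≡ true) ⇔
               ((m p o ≡ true × ¬ (inF p t ∧ b (pt p) o ≡ true)) ⊎ (outF t p ∧ b (pt p) o ≡ true))
        rule = firing-≡true (m p o) (inF p t ∧ b (pt p) o) (outF t p ∧ b (pt p) o)
        to : FiredO (orig t) β M p (o ∷ []) → firedN p o ≡ true
        to (inj₁ (marked , ¬in)) = Equivalence.from rule
          (inj₁ (trans (sym (hM p _)) marked , ¬in ∘ Equivalence.from (in-instance p o)))
        to (inj₂ out) = Equivalence.from rule (inj₂ (Equivalence.to (out-instance p o) out))
        from : firedN p o ≡ true → FiredO (orig t) β M p (o ∷ [])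
        from r with Equivalence.to rule r
        ... | inj₁ (marked , ¬in) = inj₁ (trans (hM p _) marked , ¬in ∘ Equivalence.to (in-instance p o))
        ... | inj₂ out            = inj₂ (Equivalence.from (out-instance p o) out)

      fire-T1 : FireN ot N m t b m′ ⇔ FireO ot N′ (orig t) M β M′
      fire-T1 = mk⇔ (λ (en , res) → enabled⁺ en , result⁺ res) (λ (en , res) → enabled⁻ en , result⁻ res)
        where
        EnabledN EnabledO ResultN ResultO : Set
        EnabledN = ∀ p o → inF p t ≡ true → b (pt p) o ≡ true → m p o ≡ true
        EnabledO = ∀ p ι tup → OPID.inArc N′ p (orig t) ≡ just ι → Inst ot N′ β ι tup → M p tup ≡ true
        ResultN  = ∀ p o → m′ p o ≡ firedN p o
        ResultO  = ∀ p tup → (M′ p tup ≡ true) ⇔ FiredO (orig t) β M p tup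

        enabled⁺ : EnabledN → EnabledO
        enabled⁺ en p ι tup e inst with singleArc-instance {c = inF p t} (ι , e , inst)
        ... | o , refl with Equivalence.to ∧-≡true (Equivalence.to (in-instance p o) (ι , e , inst))
        ...   | c , bo = trans (hM p _) (en p o c bo)

        enabled⁻ : EnabledO → EnabledN
        enabled⁻ en p o c bo with Equivalence.from (in-instance p o) (Equivalence.from ∧-≡true (c , bo))
        ... | ι , e , inst = trans (sym (hM p _)) (en p ι _ e inst)

        result⁺ : ResultN → ResultO
        result⁺ res p = ⇔-on-singletons (λ {tup} → T1M-singleton tup ∘ trans (sym (hM′ p tup))) fired-singleton
          λ o → ⇔-sym (fired-at p o) ⇔-∘ Equivalence.to ≡⇔≡true⇔≡true (trans (hM′ p _) (res p o))

        result⁻ : ResultO → ResultN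
        result⁻ res p o =
          trans (sym (hM′ p (o ∷ []))) (Equivalence.from ≡⇔≡true⇔≡true (fired-at p o ⇔-∘ res p (o ∷ [])))

  Placed : (Ty → Fin np) → List Obj → Fin np → List Obj → Set
  Placed pl os p tup = ∃ λ o → tup ≡ o ∷ [] × p ≡ pl (ot o) × o ∈ os

  Marks : (Ty → Fin np) → List Obj → MarkingO N′ Obj → Set
  Marks pl os M = ∀ p tup → (M p tup ≡ true) ⇔ Placed pl os p tup

  Placed-∷ : ∀ pl {o os p tup} →
    Placed pl (o ∷ os) p tup ⇔ (Placed pl os p tup ⊎ (p ≡ pl (ot o) × tup ≡ o ∷ []))
  Placed-∷ pl {o} {os} {p} {tup} = mk⇔ to from
    where
    to : Placed pl (o ∷ os) p tup → Placed pl os p tup ⊎ (p ≡ pl (ot o) × tup ≡ o ∷ [])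
    to (_ , tup≡ , p≡ , here refl)  = inj₂ (p≡ , tup≡)
    to (x , tup≡ , p≡ , there x∈os) = inj₁ (x , tup≡ , p≡ , x∈os)
    from : Placed pl os p tup ⊎ (p ≡ pl (ot o) × tup ≡ o ∷ []) → Placed pl (o ∷ os) p tup
    from (inj₁ (x , tup≡ , p≡ , x∈os)) = x , tup≡ , p≡ , there x∈os
    from (inj₂ (p≡ , tup≡))            = o , tup≡ , p≡ , here refl

  Placed-∈ : ∀ pl {os p o} → Placed pl os p (o ∷ []) → o ∈ os
  Placed-∈ _ (_ , refl , _ , o∈os) = o∈os

  M∅-marks : ∀ pl → Marks pl [] (M∅ N′)
  M∅-marks pl p tup = mk⇔ (λ ()) (λ { (_ , _ , _ , ()) })

  marking : (Ty → Fin np) → (os : List Obj) → (∀ o → Dec (o ∈ os)) → MarkingO N′ Obj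
  marking pl os ∈? p (o ∷ []) = does (p ≟ pl (ot o)) ∧ does (∈? o)
  marking pl os ∈? p _        = false

  marking-marks : ∀ pl os ∈? → Marks pl os (marking pl os ∈?)
  marking-marks pl os ∈? p []          = mk⇔ (λ ()) (λ { (_ , () , _) })
  marking-marks pl os ∈? p (_ ∷ _ ∷ _) = mk⇔ (λ ()) (λ { (_ , () , _) })
  marking-marks pl os ∈? p (o ∷ []) with p ≟ pl (ot o) | ∈? o
  ... | yes p≡ | yes o∈os = mk⇔ (λ _ → o , refl , p≡ , o∈os) (λ _ → refl)
  ... | yes _  | no o∉os  = mk⇔ (λ ()) (λ { (_ , refl , _ , o∈os) → ⊥-elim (o∉os o∈os) })
  ... | no p≢  | _        = mk⇔ (λ ()) (λ { (_ , refl , p≡ , _) → ⊥-elim (p≢ p≡) })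

  T1M-marks : ∀ pl {os} {m : MarkingN N Obj} → (∀ p o → (m p o ≡ true) ⇔ (p ≡ pl (ot o) × o ∈ os)) →
    Marks pl os (T1M {N = N} {A = A} m)
  T1M-marks _ m⇔ p []          = mk⇔ (λ ()) (λ { (_ , () , _) })
  T1M-marks _ m⇔ p (_ ∷ _ ∷ _) = mk⇔ (λ ()) (λ { (_ , () , _) })
  T1M-marks _ m⇔ p (o ∷ [])    = mk⇔ (λ h → o , refl , Equivalence.to (m⇔ p o) h)
                                     (λ { (_ , refl , on-place) → Equivalence.from (m⇔ p o) on-place })

  const-instance : ∀ {q : Fin np} {x : VarT1 Ty} o p (tup : List Obj) →
    ArcInstance (const (objV o)) (singleArc (does (p ≟ q)) x) tup ⇔ (p ≡ q × tup ≡ o ∷ [])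
  const-instance {q} {x} o p tup with p ≟ q
  ... | no p≢q   = mk⇔ (λ { (_ , () , _) }) (λ { (p≡q , _) → ⊥-elim (p≢q p≡q) })
  ... | yes refl = mk⇔ to (λ { (_ , refl) → _ , refl , inj₁ refl ∷ [] })
    where
    to : ArcInstance (const (objV o)) (just (x ∷ [])) tup → p ≡ p × tup ≡ o ∷ []
    to (_ , refl , inj₁ refl ∷ [])         = refl , refl
    to (_ , refl , inj₂ (_ , () , _) ∷ [])

  module _ {𝒪 : List Obj} where

    emit-step : ∀ {S T o} → o ∈ 𝒪 → (∀ p tup → S p tup ≡ true → o ∉ tup) →
      (∀ p tup → (T p tup ≡ true) ⇔ (S p tup ≡ true ⊎ (p ≡ play (ot o) × tup ≡ o ∷ []))) →
      StepO ot N′ 𝒪 IsEmit S T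
    emit-step {S} {T} {o} o∈𝒪 o-fresh T⇔ =
      emit (ot o) , tt , const (objV o) , valid , (λ _ _ _ ()) , fired
      where
      reads-ν : ∀ {x} → OnArc ot N′ (emit (ot o)) x → x ≡ νv (ot o)
      reads-ν (p , _ , inj₂ e , x∈ι) = singleArc-var {c = does (p ≟ play (ot o))} e x∈ι
      typed : ∀ x → OnArc ot N′ (emit (ot o)) x → WT ot N′ (kindT1 x) (objV o)
      typed x a with reads-ν a
      ... | refl = refl
      valid : ValidBindingO ot N′ 𝒪 (emit (ot o)) S (const (objV o))
      valid = typed ,
        (λ _ _ a a′ _ _ _ → trans (reads-ν a) (sym (reads-ν a′))) ,
        (λ { _ _ _ _ refl → o-fresh }) ,
        (λ _ _ → o∈𝒪)
      fired : ∀ p tup → (T p tup ≡ true) ⇔ FiredO (emit (ot o)) (const (objV o)) S p tup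
      fired p tup = mk⇔
        ([ (λ s → inj₁ (s , λ { (_ , () , _) })) , inj₂ ∘ Equivalence.from (const-instance o p tup) ]
          ∘ Equivalence.to (T⇔ p tup))
        (Equivalence.from (T⇔ p tup) ∘ [ inj₁ ∘ proj₁ , inj₂ ∘ Equivalence.to (const-instance o p tup) ])

    consume-step : ∀ {S T o} → o ∈ 𝒪 → S (stop (ot o)) (o ∷ []) ≡ true →
      (∀ p tup → (T p tup ≡ true) ⇔ (S p tup ≡ true × ¬ (p ≡ stop (ot o) × tup ≡ o ∷ []))) →
      StepO ot N′ 𝒪 IsCons S T
    consume-step {S} {T} {o} o∈𝒪 marked T⇔ =
      cons (ot o) , tt , const (objV o) , valid , enabled , fired
      where
      reads-x : ∀ {x} → OnArc ot N′ (cons (ot o)) x → x ≡ xv (ot o)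
      reads-x (p , _ , inj₁ e , x∈ι) = singleArc-var {c = does (p ≟ stop (ot o))} e x∈ι
      not-fresh : ∀ {x} → OnArc ot N′ (cons (ot o)) x → ¬ IsFresh ot N′ x
      not-fresh a x-fresh with reads-x a
      not-fresh a (_ , ()) | refl
      typed : ∀ x → OnArc ot N′ (cons (ot o)) x → WT ot N′ (kindT1 x) (objV o)
      typed x a with reads-x a
      ... | refl = refl
      valid : ValidBindingO ot N′ 𝒪 (cons (ot o)) S (const (objV o))
      valid = typed ,
        (λ _ _ a _ x-fresh → ⊥-elim (not-fresh a x-fresh)) ,
        (λ _ _ a x-fresh → ⊥-elim (not-fresh a x-fresh)) ,
        (λ _ _ → o∈𝒪)
      enabled : ∀ p ι tup → OPID.inArc N′ p (cons (ot o)) ≡ just ι → Inst ot N′ (const (objV o)) ι tup →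
                S p tup ≡ true
      enabled p ι tup e inst with Equivalence.to (const-instance o p tup) (ι , e , inst)
      ... | refl , refl = marked
      fired : ∀ p tup → (T p tup ≡ true) ⇔ FiredO (cons (ot o)) (const (objV o)) S p tup
      fired p tup = mk⇔
        (λ t → let (s , kept) = Equivalence.to (T⇔ p tup) t in
               inj₁ (s , kept ∘ Equivalence.to (const-instance o p tup)))
        [ (λ (s , ¬in) → Equivalence.from (T⇔ p tup) (s , ¬in ∘ Equivalence.from (const-instance o p tup))) ,
          (λ { (_ , () , _) }) ]

    emit-extends : ∀ {S T o os} → o ∈ 𝒪 → o ∉ os → Marks play os S → Marks play (o ∷ os) T →
      StepO ot N′ 𝒪 IsEmit S T
    emit-extends {S} {T} {o} {os} o∈𝒪 o∉os S-marks T-marks = emit-step o∈𝒪 o-fresh T⇔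
      where
      o-fresh : ∀ p tup → S p tup ≡ true → o ∉ tup
      o-fresh p tup s o∈tup with Equivalence.to (S-marks p tup) s
      ... | _ , refl , _ , x∈os = o∉os (subst (_∈ os) (sym (singleton⁻ o∈tup)) x∈os)
      T⇔ : ∀ p tup → (T p tup ≡ true) ⇔ (S p tup ≡ true ⊎ (p ≡ play (ot o) × tup ≡ o ∷ []))
      T⇔ p tup = mk⇔
        (map₁ (Equivalence.from (S-marks p tup)) ∘ Equivalence.to (Placed-∷ play) ∘ Equivalence.to (T-marks p tup))
        (Equivalence.from (T-marks p tup) ∘ Equivalence.from (Placed-∷ play) ∘ map₁ (Equivalence.to (S-marks p tup)))

    consume-extends : ∀ {S T o os} → o ∈ 𝒪 → o ∉ os → Marks stop (o ∷ os) S → Marks stop os T →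
      StepO ot N′ 𝒪 IsCons S T
    consume-extends {S} {T} {o} {os} o∈𝒪 o∉os S-marks T-marks =
      consume-step o∈𝒪 (Equivalence.from (S-marks _ _) (o , refl , refl , here refl)) T⇔
      where
      T⇔ : ∀ p tup → (T p tup ≡ true) ⇔ (S p tup ≡ true × ¬ (p ≡ stop (ot o) × tup ≡ o ∷ []))
      T⇔ p tup = mk⇔
        (λ t → let placed = Equivalence.to (T-marks p tup) t in
          Equivalence.from (S-marks p tup) (Equivalence.from (Placed-∷ stop) (inj₁ placed)) ,
          λ { (_ , refl) → o∉os (Placed-∈ stop placed) })
        (λ (s , kept) → Equivalence.from (T-marks p tup)
          ([ id , ⊥-elim ∘ kept ] (Equivalence.to (Placed-∷ stop) (Equivalence.to (S-marks p tup) s))))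

    emitting : ∀ {T} o os → o ∷ os ⊆ 𝒪 → Unique (o ∷ os) → (∀ x → Dec (x ∈ o ∷ os)) →
      Marks play (o ∷ os) T → Star (StepO ot N′ 𝒪 IsEmit) (M∅ N′) T
    emitting o [] ⊆𝒪 _ _ T-marks =
      return (emit-extends (⊆𝒪 (here refl)) (λ ()) (M∅-marks play) T-marks)
    emitting o (o′ ∷ os) ⊆𝒪 u@(_ ∷ u′) ∈? T-marks =
      emitting o′ os (⊆𝒪 ∘ there) u′ ∈?′ (marking-marks play _ ∈?′)
      ◅◅ return (emit-extends (⊆𝒪 (here refl)) (Unique[x∷xs]⇒x∉xs u) (marking-marks play _ ∈?′) T-marks)
      where
      ∈?′ : ∀ x → Dec (x ∈ o′ ∷ os)
      ∈?′ = ∈-tail? u ∈?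

    collapsing : ∀ {S} o os → o ∷ os ⊆ 𝒪 → Unique (o ∷ os) → (∀ x → Dec (x ∈ o ∷ os)) →
      Marks stop (o ∷ os) S → Star (StepO ot N′ 𝒪 IsCons) S (M∅ N′)
    collapsing o [] ⊆𝒪 _ _ S-marks =
      return (consume-extends (⊆𝒪 (here refl)) (λ ()) S-marks (M∅-marks stop))
    collapsing o (o′ ∷ os) ⊆𝒪 u@(_ ∷ u′) ∈? S-marks =
      consume-extends (⊆𝒪 (here refl)) (Unique[x∷xs]⇒x∉xs u) S-marks (marking-marks stop _ ∈?′)
      ◅ collapsing o′ os (⊆𝒪 ∘ there) u′ ∈?′ (marking-marks stop _ ∈?′)
      where
      ∈?′ : ∀ x → Dec (x ∈ o′ ∷ os)
      ∈?′ = ∈-tail? u ∈?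

  Within : List Obj → MarkingN N Obj → Set
  Within 𝒪 m = ∀ p o → m p o ≡ true → o ∈ 𝒪

  firing-within : ∀ {𝒪 m m′ t b} → ValidBindingN ot N 𝒪 t b → FireN ot N m t b m′ → Within 𝒪 m → Within 𝒪 m′
  firing-within {m = m} vb (_ , m′≡) within p o h
    with Equivalence.to (firing-≡true (m p o) _ _) (trans (sym (m′≡ p o)) h)
  ... | inj₁ (marked , _) = within p o marked
  ... | inj₂ produced     = proj₂ (proj₂ (proj₁ vb (pt p) o (proj₂ (Equivalence.to ∧-≡true produced))))

  init-within : ∀ {𝒪 m} → IsInit ot N A 𝒪 m → Within 𝒪 m
  init-within init p o = proj₂ ∘ Equivalence.to (init p o)

  run-within : ∀ {𝒪 n} {ts : Fin n → Fin nt} {bs : Fin n → Ty → Obj → Bool} {Ms : Fin (suc n) → MarkingN N Obj} →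
    (∀ i → ValidBindingN ot N 𝒪 (ts i) (bs i)) →
    (∀ i → FireN ot N (Ms (inject₁ i)) (ts i) (bs i) (Ms (suc i))) →
    Within 𝒪 (Ms zero) → ∀ i → Within 𝒪 (Ms i)
  run-within {𝒪} {Ms = Ms} vb fire within₀ =
    <-weakInduction (Within 𝒪 ∘ Ms) within₀ (λ i → firing-within (vb i) (fire i))

  -- Markings are functions and Star relates them up to ≡, so for 𝒪 = [] the run must start and end at
  -- M∅ itself (no emitting or consuming step is possible); T1M m is only extensionally empty there.
  T1M⁺ : List Obj → MarkingN N Obj → MarkingO N′ Obj
  T1M⁺ []      _ = M∅ N′
  T1M⁺ (_ ∷ _) m = T1M {N = N} {A = A} m

  T1M⁺-represents : ∀ {𝒪 m} → Within 𝒪 m → Represents (T1M⁺ 𝒪 m) m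
  T1M⁺-represents {_ ∷ _} _ _ _ = refl
  T1M⁺-represents {[]}    _ _ []          = refl
  T1M⁺-represents {[]}    _ _ (_ ∷ _ ∷ _) = refl
  T1M⁺-represents {[]} {m} within p (o ∷ []) with m p o in marked
  ... | false = refl
  ... | true with () ← within p o marked

  -- Obj need not have decidable equality; M_init is a Boolean function marking exactly 𝒪.
  init-∈? : ∀ {𝒪 m} → IsInit ot N A 𝒪 m → ∀ o → Dec (o ∈ 𝒪)
  init-∈? {m = m} init o =
    map′ (proj₂ ∘ Equivalence.to (init _ o)) (λ o∈𝒪 → Equivalence.from (init _ o) (refl , o∈𝒪))
         (m (play (ot o)) o ≟ᵇ true)

  emit-init : ∀ {𝒪 m} → Unique 𝒪 → IsInit ot N A 𝒪 m → Star (StepO ot N′ 𝒪 IsEmit) (M∅ N′) (T1M⁺ 𝒪 m)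
  emit-init {[]}     _ _    = ε
  emit-init {o ∷ os} u init = emitting o os id u (init-∈? init) (T1M-marks play init)

  collapse-final : ∀ {𝒪 m} → Unique 𝒪 → (∀ o → Dec (o ∈ 𝒪)) → IsFinal ot N A 𝒪 m →
    Star (StepO ot N′ 𝒪 IsCons) (T1M⁺ 𝒪 m) (M∅ N′)
  collapse-final {[]}     _ _  _     = ε
  collapse-final {o ∷ os} u ∈? final = collapsing o os id u ∈? (T1M-marks stop final)

  selected : (Ty → Obj → Bool) → Ty → List Obj → List Obj
  selected b σ = filter (λ o → b σ o ≟ᵇ true)

  -- x_σ is only read when b(σ) is a singleton, and ν_σ never occurs on the arcs of an original transition.
  T1-binding : List Obj → (Ty → Obj → Bool) → VarT1 Ty → Val Obj
  T1-binding 𝒪 b (xv σ) = headVal (selected b σ 𝒪)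
  T1-binding 𝒪 b (Xv σ) = listV (selected b σ 𝒪)
  T1-binding 𝒪 b (νv σ) = listV []

  T1-binding-isT1 : ∀ {𝒪 t b} → Unique 𝒪 → ValidBindingN ot N 𝒪 t b → IsT1Binding N t b (T1-binding 𝒪 b)
  T1-binding-isT1 {𝒪} {t} {b} u vb = single , listed
    where
    ∈-selected : ∀ σ o → (o ∈ selected b σ 𝒪) ⇔ (b σ o ≡ true)
    ∈-selected σ o = mk⇔ (proj₂ ∘ ∈-filter⁻ (λ o → b σ o ≟ᵇ true) {xs = 𝒪})
                         (λ bo → ∈-filter⁺ (λ o → b σ o ≟ᵇ true) (proj₂ (proj₂ (proj₁ vb σ o bo))) bo)
    single : ∀ σ → TplNv N t σ → ∀ o → b σ o ≡ true → headVal (selected b σ 𝒪) ≡ objV o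
    single σ nv o bo with proj₂ vb σ nv
    ... | _ , _ , unique = headVal-≡ (Equivalence.from (∈-selected σ o) bo)
            (λ {o′} o′∈ → trans (unique o′ (Equivalence.to (∈-selected σ o′) o′∈)) (sym (unique o bo)))
    listed : ∀ σ → TplVar N t σ →
      ∃ λ os → listV (selected b σ 𝒪) ≡ listV os × Unique os × (∀ o → (o ∈ os) ⇔ (b σ o ≡ true))
    listed σ _ = selected b σ 𝒪 , refl , filter⁺ (λ o → b σ o ≟ᵇ true) u , ∈-selected σ

theorem1 : {Ty Obj Act : Set} (ot : Obj → Ty) (𝒪 : List Obj) → Unique 𝒪 →
  (N : OCPN Ty Act) → WellFormed N → (A : Accepting N) →
  (n : ℕ) (ts : Fin n → Fin (OCPN.nt N)) (bs : Fin n → Ty → Obj → Bool)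
  (Ms : Fin (suc n) → MarkingN N Obj) →
  (∀ i → ValidBindingN ot N 𝒪 (ts i) (bs i)) →
  IsInit ot N A 𝒪 (Ms zero) → IsFinal ot N A 𝒪 (Ms (fromℕ n)) →
  ((∀ i → FireN ot N (Ms (inject₁ i)) (ts i) (bs i) (Ms (suc i)))
   ⇔ (Σ (Fin n → VarT1 Ty → Val Obj) λ βs →
      Σ (Fin (suc n) → MarkingO (T1 N A) Obj) λ Ms' →
        (∀ i p tup → Ms' i p tup ≡ T1M {N = N} {A = A} (Ms i) p tup) ×
        (∀ i → IsT1Binding N (ts i) (bs i) (βs i)) ×
        Star (StepO ot (T1 N A) 𝒪 IsEmit) (M∅ (T1 N A)) (Ms' zero) ×
        (∀ i → ValidBindingO ot (T1 N A) 𝒪 (orig (ts i)) (Ms' (inject₁ i)) (βs i)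
             × FireO ot (T1 N A) (orig (ts i)) (Ms' (inject₁ i)) (βs i) (Ms' (suc i))) ×
        Star (StepO ot (T1 N A) 𝒪 IsCons) (Ms' (fromℕ n)) (M∅ (T1 N A))))
theorem1 ot 𝒪 u N _ A n ts bs Ms vb init final = mk⇔
  (λ fire → (λ i → T1-binding 𝒪 (bs i)) , (λ i → T1M⁺ 𝒪 (Ms i)) , represents fire , isT1 ,
    emit-init u init ,
    (λ i → orig-valid (vb i) (isT1 i) _ ,
           Equivalence.to (fire-T1 (vb i) (isT1 i) (represents fire (inject₁ i)) (represents fire (suc i)))
                          (fire i)) ,
    collapse-final u (init-∈? init) final)
  (λ (_ , _ , hMs , hβs , _ , steps , _) i →
    Equivalence.from (fire-T1 (vb i) (hβs i) (hMs (inject₁ i)) (hMs (suc i))) (proj₂ (steps i)))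
  where
  open Simulation ot A

  isT1 : ∀ i → IsT1Binding N (ts i) (bs i) (T1-binding 𝒪 (bs i))
  isT1 i = T1-binding-isT1 u (vb i)

  represents : (∀ i → FireN ot N (Ms (inject₁ i)) (ts i) (bs i) (Ms (suc i))) →
               ∀ i → Represents (T1M⁺ 𝒪 (Ms i)) (Ms i)
  represents fire i = T1M⁺-represents (run-within vb fire (init-within init) i)
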